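{- Let $G=G^{(0)}$ be a signed graph with canonical marking, having $n_+$ positively marked and $n_-$ negatively marked nodes, $n=n_++n_-$, and let $G^{(m)}$ be the signed corona graphs generated by $G$. Let $1\le i\le m$ and let $v$ be a node that appears at step $i$, i.e. $v$ is a node of a copy of $G$ attached to a node $u$ of $G^{(i-1)}$ in forming $G^{(i)}=G^{(i-1)}\circ G$. Let $d_0^\pm(v)$ and $\mu_0(v)$ be the positive/negative degree and canonical marking of $v$ as a node of $G$, and $\mu(u)$ the canonical marking of $u$ in $G^{(i-1)}$. Then the positive and negative degrees $d^+(v),d^-(v)$ of $v$ in $G^{(m)}$ are: (1) $n_+,n_-$ both odd. If $m,i$ have the same parity: for $(\mu(u),\mu_0(v))=(+,+)$ or $(-,-)$, $d^+(v)=d_0^+(v)+1+\frac{m-i}{2}n$, $d^-(v)=d_0^-(v)+\frac{m-i}{2}n$; for $(+,-)$ or $(-,+)$, $d^+(v)=d_0^+(v)+\frac{m-i}{2}n$, $d^-(v)=d_0^-(v)+1+\frac{m-i}{2}n$. If $m,i$ have different parity: for $(+,+)$, $d^+=d_0^++1+\frac{m-i+1}{2}n_++\frac{m-i-1}{2}n_-$, $d^-=d_0^-+\frac{m-i+1}{2}n_-+\frac{m-i-1}{2}n_+$; for $(+,-)$, $d^+=d_0^++\frac{m-i+1}{2}n_++\frac{m-i-1}{2}n_-$, $d^-=d_0^-+1+\frac{m-i+1}{2}n_-+\frac{m-i-1}{2}n_+$; for $(-,+)$, $d^+=d_0^++\frac{m-i+1}{2}n_-+\frac{m-i-1}{2}n_+$,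 $d^-=d_0^-+1+\frac{m-i+1}{2}n_++\frac{m-i-1}{2}n_-$; for $(-,-)$, $d^+=d_0^++1+\frac{m-i+1}{2}n_-+\frac{m-i-1}{2}n_+$, $d^-=d_0^-+\frac{m-i+1}{2}n_++\frac{m-i-1}{2}n_-$. (2) $n_+$ even, $n_-$ odd. For $(+,+)$: if $m>i$, $d^+=d_0^++1+n_++(m-i-1)n_-$, $d^-=d_0^-+n_-+(m-i-1)n_+$; if $m=i$, $d^+=d_0^++1$, $d^-=d_0^-$. For $(+,-)$: if $m>i$, $d^+=d_0^++n_++(m-i-1)n_-$, $d^-=d_0^-+1+n_-+(m-i-1)n_+$; if $m=i$, $d^+=d_0^+$, $d^-=d_0^-+1$. For $(-,+)$: $d^+=d_0^++(m-i)n_-$, $d^-=d_0^-+1+(m-i)n_+$. For $(-,-)$: $d^+=d_0^++1+(m-i)n_-$, $d^-=d_0^-+(m-i)n_+$. (3) $n_+,n_-$ both even. For $(+,+)$: $d^+=d_0^++1+(m-i)n_+$, $d^-=d_0^-+(m-i)n_-$. For $(+,-)$: $d^+=d_0^++(m-i)n_+$, $d^-=d_0^-+1+(m-i)n_-$. For $(-,+)$: $d^+=d_0^++(m-i)n_-$, $d^-=d_0^-+1+(m-i)n_+$. For $(-,-)$: $d^+=d_0^++1+(m-i)n_-$, $d^-=d_0^-+(m-i)n_+$. (4) $n_+$ odd, $n_-$ even. For $(+,+)$: $d^+=d_0^++1+(m-i)n_+$, $d^-=d_0^-+(m-i)n_-$. For $(+,-)$: $d^+=d_0^++(m-i)n_+$,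 $d^-=d_0^-+1+(m-i)n_-$. For $(-,+)$: if $m>i$, $d^+=d_0^++n_-+(m-i-1)n_+$, $d^-=d_0^-+1+n_++(m-i-1)n_-$; if $m=i$, $d^+=d_0^+$, $d^-=d_0^-+1$. For $(-,-)$: if $m>i$, $d^+=d_0^++1+n_-+(m-i-1)n_+$, $d^-=d_0^-+n_++(m-i-1)n_-$; if $m=i$, $d^+=d_0^++1$, $d^-=d_0^-$. (Here $d^\pm$ abbreviates $d^\pm(v)$ and $d_0^\pm$ abbreviates $d_0^\pm(v)$.)
   Context: A signed graph has edges signed $+$ or $-$; $d^\pm(v)$ are the numbers of positive/negative edges at $v$. The canonical marking of a node $v$ is $\mu(v)=\prod_{e\ni v}\sigma(e)$, the product of the signs of all edges incident to $v$ (so $\mu(v)=+$ iff $d^-(v)$ is even). Corona product of signed graphs $H_1$ (nodes $u_1,\dots,u_N$) and $H_2$, each canonically marked: take one copy of $H_1$ and $N$ copies of $H_2$ and join $u_i$ to every node of the $i$-th copy of $H_2$, the edge from $u_i$ to the copy of $w$ having sign $\mu_{H_1}(u_i)\mu_{H_2}(w)$. Signed corona graphs generated by the seed graph $G$: $G^{(0)}=G$ and $G^{(m)}=G^{(m-1)}\circ G$ for $m\ge1$, where at each step $G^{(m-1)}$ carries its own canonical marking (as a signed graph) and $G$ its canonical marking. Nodes of $G^{(i)}$ are regarded as nodes of every $G^{(m)}$, $m\ge i$. -}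

module Defs where

open import Data.Nat using (ℕ; zero; suc; _+_; _*_)
open import Data.Fin using (Fin; zero; suc; splitAt; remQuot; _↑ˡ_; _↑ʳ_; combine)
open import Data.Fin.Properties using (_≟_)
open import Data.Maybe using (Maybe; just; nothing)
open import Data.Sum using (inj₁; inj₂)
open import Data.Product using (_,_; _×_)
open import Data.Bool using (if_then_else_)
open import Relation.Nullary.Decidable using (⌊_⌋)
open import Relation.Binary.PropositionalEquality using (_≡_)

data Sign : Set where
  pos neg : Sign

_·_ : Sign → Sign → Sign
pos · s = s
neg · pos = neg
neg · neg = pos

-- A signed graph on the node set Fin N: adj a b = nothing if there is no
-- edge between a and b, and just s if there is an edge of sign s.
SGraph : ℕ → Set
SGraph N = Fin N → Fin N → Maybe Sign

IsSimple : ∀ {N} → SGraph N → Set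
IsSimple {N} H = (∀ a b → H a b ≡ H b a) × (∀ a → H a a ≡ nothing)

Σ : ∀ {n} → (Fin n → ℕ) → ℕ
Σ {zero} f = 0
Σ {suc n} f = f zero + Σ (λ x → f (suc x))

Π : ∀ {n} → (Fin n → Sign) → Sign
Π {zero} g = pos
Π {suc n} g = g zero · Π (λ x → g (suc x))

isSign : Sign → Maybe Sign → ℕ
isSign pos (just pos) = 1
isSign neg (just neg) = 1
isSign _ _ = 0

d⁺ : ∀ {N} → SGraph N → Fin N → ℕ
d⁺ H v = Σ (λ w → isSign pos (H v w))

d⁻ : ∀ {N} → SGraph N → Fin N → ℕ
d⁻ H v = Σ (λ w → isSign neg (H v w))

signOr+ : Maybe Sign → Sign
signOr+ (just s) = s
signOr+ nothing = pos

μ : ∀ {N} → SGraph N → Fin N → Sign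
μ H v = Π (λ w → signOr+ (H v w))

nPos : ∀ {N} → SGraph N → ℕ
nPos H = Σ (λ v → isSign pos (just (μ H v)))

nNeg : ∀ {N} → SGraph N → ℕ
nNeg H = Σ (λ v → isSign neg (just (μ H v)))

-- Corona product H ∘ K.  Node set Fin (N + N * M): the first N nodes are
-- the nodes of H; node  N ↑ʳ combine a w  is the copy of node w of K in the
-- a-th copy of K (attached to node a of H).
corona : ∀ {N M} → SGraph N → SGraph M → SGraph (N + N * M)
corona {N} {M} H K x y with splitAt N x | splitAt N y
... | inj₁ a | inj₁ b = H a b
... | inj₁ a | inj₂ q with remQuot {N} M q
...   | (j , w) = if ⌊ a ≟ j ⌋ then just (μ H a · μ K w) else nothing
corona {N} {M} H K x y | inj₂ p | inj₁ b with remQuot {N} M p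
...   | (j , w) = if ⌊ b ≟ j ⌋ then just (μ H b · μ K w) else nothing
corona {N} {M} H K x y | inj₂ p | inj₂ q with remQuot {N} M p | remQuot {N} M q
...   | (i , w) | (j , w') = if ⌊ i ≟ j ⌋ then K w w' else nothing

size : ℕ → ℕ → ℕ
size n zero = n
size n (suc m) = size n m + size n m * n

coronaPow : ∀ {n} → SGraph n → (m : ℕ) → SGraph (size n m)
coronaPow G zero = G
coronaPow {n} G (suc m) = corona (coronaPow G m) G

emb : ∀ n i k → Fin (size n i) → Fin (size n (k + i))
emb n i zero x = x
emb n i (suc k) x = emb n i k x ↑ˡ (size n (k + i) * n)

newNode : ∀ n i → Fin (size n i) → Fin n → Fin (size n (suc i))
newNode n i u w = size n i ↑ʳ combine u w

module Submission where

-- The proof follows a single node v through the corona steps.  Its state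
-- (marking, positive degree, negative degree) evolves by a fixed map: in
-- H ∘ G an old node marked s gains an edge to each node of its copy of G,
-- of which c s are positive and c (−s) negative, where c t is the number of
-- nodes of G marked t; since μ(v) = (−1)^{d⁻(v)}, its marking is multiplied
-- by (−1)^{c(−s)}.  A node created at step i starts from a state read off
-- from G and the node it is attached to.
--
-- The
-- iterate is solved in closed form (module Dynamics) according to whether a
-- marking is fixed, flips once, or alternates; which happens depends on the
-- parities of n₊ and n₋, giving the four cases of the theorem.

open import Defs
open import Data.Nat using (ℕ; zero; suc; _+_; _*_; _∸_; _<_; _/_; _%_)
open import Data.Nat.Properties
  using (+-assoc; +-comm; +-identityʳ; m+n∸n≡m; <-irrefl; m≢1+n+m; 0≢1+n; 1+n≢0; +-commutativeSemigroup)
open import Algebra.Properties.CommutativeSemigroup +-commutativeSemigroup using () renaming (interchange to +-interchange)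
open import Data.Nat.DivMod using (m*n/n≡m; m*n%n≡0; [m+kn]%n≡m%n)
open import Data.Nat.Divisibility using (_∣_; divides)
open import Data.Nat.GeneralisedArithmetic using (fold; fold-+)
open import Data.Nat.Solver using (module +-*-Solver)
open import Data.Fin using (Fin; zero; suc; _↑ˡ_; _↑ʳ_; combine; quotRem)
open import Data.Fin.Properties using (_≟_; splitAt-↑ˡ; splitAt-↑ʳ; remQuot-combine)
open import Data.Maybe using (Maybe; just; nothing)
open import Data.Bool using (if_then_else_)
open import Data.Product using (_×_; _,_; swap)
open import Data.Empty using (⊥-elim)
open import Relation.Nullary using (¬_; Dec)
open import Relation.Nullary.Decidable using (⌊_⌋; isYes≗does; dec-true; dec-false)
open import Relation.Binary.PropositionalEquality

·-assoc : ∀ x y z → (x · y) · z ≡ x · (y · z)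
·-assoc pos y z = refl
·-assoc neg pos z = refl
·-assoc neg neg pos = refl
·-assoc neg neg neg = refl

·-cancelʳ : ∀ x y → (x · y) · y ≡ x
·-cancelʳ pos pos = refl
·-cancelʳ pos neg = refl
·-cancelʳ neg pos = refl
·-cancelʳ neg neg = refl

neg^ : ℕ → Sign
neg^ zero = pos
neg^ (suc k) = neg · neg^ k

neg^-+ : ∀ a b → neg^ (a + b) ≡ neg^ a · neg^ b
neg^-+ zero b = refl
neg^-+ (suc a) b = trans (cong (neg ·_) (neg^-+ a b)) (sym (·-assoc neg (neg^ a) (neg^ b)))

data Parity : ℕ → Set where
  even : ∀ h → Parity (h * 2)
  odd  : ∀ h → Parity (1 + h * 2)

parity : ∀ k → Parity k
parity zero = even 0
parity (suc k) with parity k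
... | even h = odd h
... | odd h = even (suc h)

neg^-even : ∀ h → neg^ (h * 2) ≡ pos
neg^-even zero = refl
neg^-even (suc h) rewrite neg^-even h = refl

neg^-odd : ∀ h → neg^ (1 + h * 2) ≡ neg
neg^-odd h = cong (neg ·_) (neg^-even h)

even⇒neg^≡pos : ∀ {p} → 2 ∣ p → neg^ p ≡ pos
even⇒neg^≡pos (divides h refl) = neg^-even h

odd⇒neg^≡neg : ∀ {p} → ¬ (2 ∣ p) → neg^ p ≡ neg
odd⇒neg^≡neg {p} p-odd with parity p
... | even h = ⊥-elim (p-odd (divides h refl))
... | odd h = neg^-odd h

suc-%2-≢ : ∀ i → suc i % 2 ≢ i % 2
suc-%2-≢ i with parity i
... | even g = λ eq → 1+n≢0 (trans (sym ([m+kn]%n≡m%n 1 g 2)) (trans eq (m*n%n≡0 g 2)))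
... | odd g = λ eq → 0≢1+n (trans (sym (m*n%n≡0 (suc g) 2)) (trans eq ([m+kn]%n≡m%n 1 g 2)))

even-+-%2 : ∀ h i → (h * 2 + i) % 2 ≡ i % 2
even-+-%2 h i = trans (cong (_% 2) (+-comm (h * 2) i)) ([m+kn]%n≡m%n i h 2)

odd-+-%2 : ∀ h i → (1 + h * 2 + i) % 2 ≢ i % 2
odd-+-%2 h i eq = suc-%2-≢ i (trans (sym shift) eq)
  where shift : (1 + h * 2 + i) % 2 ≡ suc i % 2
        shift = trans (cong (λ x → suc x % 2) (+-comm (h * 2) i)) ([m+kn]%n≡m%n (suc i) h 2)

half-even : ∀ h → (h * 2) / 2 ≡ h
half-even h = m*n/n≡m h 2

half-odd-up : ∀ h → (1 + h * 2 + 1) / 2 ≡ suc h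
half-odd-up h = trans (cong (_/ 2) (+-comm (1 + h * 2) 1)) (m*n/n≡m (suc h) 2)

Σ-cong : ∀ {n} {f g : Fin n → ℕ} → (∀ x → f x ≡ g x) → Σ f ≡ Σ g
Σ-cong {zero} eq = refl
Σ-cong {suc n} eq = cong₂ _+_ (eq zero) (Σ-cong (λ x → eq (suc x)))

Σ-zero : ∀ {n} (f : Fin n → ℕ) → (∀ x → f x ≡ 0) → Σ f ≡ 0
Σ-zero {zero} f eq = refl
Σ-zero {suc n} f eq = cong₂ _+_ (eq zero) (Σ-zero (λ x → f (suc x)) (λ x → eq (suc x)))

Σ-single : ∀ {n} (a : Fin n) (f : Fin n → ℕ) → (∀ x → x ≢ a → f x ≡ 0) → Σ f ≡ f a
Σ-single {suc n} zero f off =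
  trans (cong (f zero +_) (Σ-zero (λ x → f (suc x)) (λ x → off (suc x) (λ ())))) (+-identityʳ (f zero))
Σ-single {suc n} (suc a) f off =
  trans (cong (_+ Σ (λ x → f (suc x))) (off zero (λ ())))
        (Σ-single a (λ x → f (suc x)) (λ x x≢a → off (suc x) (λ { refl → x≢a refl })))

Σ-+ : ∀ {n} (f g : Fin n → ℕ) → Σ (λ x → f x + g x) ≡ Σ f + Σ g
Σ-+ {zero} f g = refl
Σ-+ {suc n} f g = trans (cong (f zero + g zero +_) (Σ-+ (λ x → f (suc x)) (λ x → g (suc x))))
                        (+-interchange (f zero) (g zero) (Σ (λ x → f (suc x))) (Σ (λ x → g (suc x))))

Σ-one : ∀ n → Σ {n} (λ _ → 1) ≡ n
Σ-one zero = refl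
Σ-one (suc n) = cong suc (Σ-one n)

Σ-↑ : ∀ N {M} (f : Fin (N + M) → ℕ) → Σ f ≡ Σ (λ x → f (x ↑ˡ M)) + Σ (λ y → f (N ↑ʳ y))
Σ-↑ zero f = refl
Σ-↑ (suc N) f = trans (cong (f zero +_) (Σ-↑ N (λ x → f (suc x))))
                      (sym (+-assoc (f zero) _ _))

Σ-combine : ∀ N {M} (f : Fin (N * M) → ℕ) → Σ f ≡ Σ {N} (λ j → Σ {M} (λ w → f (combine j w)))
Σ-combine zero f = refl
Σ-combine (suc N) {M} f =
  trans (Σ-↑ M f) (cong (Σ (λ w → f (w ↑ˡ N * M)) +_) (Σ-combine N (λ y → f (M ↑ʳ y))))

signOr+≡neg^ : ∀ x → signOr+ x ≡ neg^ (isSign neg x)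
signOr+≡neg^ (just pos) = refl
signOr+≡neg^ (just neg) = refl
signOr+≡neg^ nothing = refl

Π-signOr+ : ∀ {n} (g : Fin n → Maybe Sign) →
  Π (λ w → signOr+ (g w)) ≡ neg^ (Σ (λ w → isSign neg (g w)))
Π-signOr+ {zero} g = refl
Π-signOr+ {suc n} g =
  trans (cong₂ _·_ (signOr+≡neg^ (g zero)) (Π-signOr+ (λ x → g (suc x))))
        (sym (neg^-+ (isSign neg (g zero)) _))

neg^-isSign : ∀ x → neg^ (isSign neg (just x)) ≡ x
neg^-isSign pos = refl
neg^-isSign neg = refl

μ≡neg^d⁻ : ∀ {N} (H : SGraph N) v → μ H v ≡ neg^ (d⁻ H v)
μ≡neg^d⁻ H v = Π-signOr+ (H v)

if-yes : ∀ {P : Set} (d : Dec P) → P → ∀ {A : Set} {x y : A} → (if ⌊ d ⌋ then x else y) ≡ x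
if-yes d p = cong (if_then _ else _) (trans (isYes≗does d) (dec-true d p))

if-no : ∀ {P : Set} (d : Dec P) → ¬ P → ∀ {A : Set} {x y : A} → (if ⌊ d ⌋ then x else y) ≡ y
if-no d ¬p = cong (if_then _ else _) (trans (isYes≗does d) (dec-false d ¬p))

deg : ∀ {N} → Sign → SGraph N → Fin N → ℕ
deg s H v = Σ (λ w → isSign s (H v w))

count : ∀ {N} → Sign → SGraph N → ℕ
count s H = Σ (λ v → isSign s (just (μ H v)))

isSign-nothing : ∀ s → isSign s nothing ≡ 0
isSign-nothing pos = refl
isSign-nothing neg = refl

isSign-shift : ∀ s t x → isSign s (just (t · x)) ≡ isSign (s · t) (just x)
isSign-shift pos pos x = refl
isSign-shift pos neg pos = refl
isSign-shift pos neg neg = refl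
isSign-shift neg pos x = refl
isSign-shift neg neg pos = refl
isSign-shift neg neg neg = refl

count-total : ∀ {N} (H : SGraph N) → N ≡ count pos H + count neg H
count-total {N} H = sym (begin
  count pos H + count neg H
    ≡⟨ Σ-+ (λ v → isSign pos (just (μ H v))) (λ v → isSign neg (just (μ H v))) ⟨
  Σ (λ v → isSign pos (just (μ H v)) + isSign neg (just (μ H v)))
    ≡⟨ Σ-cong (λ v → one (μ H v)) ⟩
  Σ {N} (λ _ → 1)
    ≡⟨ Σ-one N ⟩
  N ∎)
  where
  open ≡-Reasoning
  one : ∀ s → isSign pos (just s) + isSign neg (just s) ≡ 1
  one pos = refl
  one neg = refl

record State : Set where
  constructor ⟨_,_,_⟩
  field
    mark : Sign
    plus minus : ℕ
open State

stateOf : ∀ {N} → SGraph N → Fin N → State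
stateOf H v = ⟨ μ H v , d⁺ H v , d⁻ H v ⟩

⟨⟩-cong : ∀ {s s' a a' b b'} → s ≡ s' → a ≡ a' → b ≡ b' → ⟨ s , a , b ⟩ ≡ ⟨ s' , a' , b' ⟩
⟨⟩-cong refl refl refl = refl

-- How the state of an existing node changes in one corona step, when the
-- attached graph has c s nodes marked s: a node marked s receives c s
-- positive and c (neg · s) negative edges, and its marking changes by the
-- parity of the latter.
nextMark : (Sign → ℕ) → Sign → Sign
nextMark c s = s · neg^ (c (neg · s))

step : (Sign → ℕ) → State → State
step c ⟨ s , a , b ⟩ = ⟨ nextMark c s , a + c s , b + c (neg · s) ⟩

-- The state of a freshly attached node with marking t in its own copy of K,
-- degrees (a , b) in K, and edge of sign e to the node it is attached to.
seed : (t e : Sign) → ℕ → ℕ → State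
seed t pos a b = ⟨ t , a + 1 , b ⟩
seed t neg a b = ⟨ t , a , b + 1 ⟩

-- The state, after k further corona steps, of a node created with marking
-- μu, degrees d0⁺ d0⁻ in its copy of G and marking μ0 there.
run : (c : Sign → ℕ) (k d0⁺ d0⁻ : ℕ) (μu μ0 : Sign) → State
run c k d0⁺ d0⁻ μu μ0 = fold (seed μu (μu · μ0) d0⁺ d0⁻) (step c) k

seed-spec : ∀ t e a b → ⟨ t , isSign pos (just e) + a , isSign neg (just e) + b ⟩ ≡ seed t e a b
seed-spec t pos a b = cong (λ x → ⟨ t , x , b ⟩) (+-comm 1 a)
seed-spec t neg a b = cong (λ x → ⟨ t , a , x ⟩) (+-comm 1 b)

module Corona {N M : ℕ} (H : SGraph N) (K : SGraph M) where

  old : Fin N → Fin (N + N * M)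
  old a = a ↑ˡ N * M

  new : Fin N → Fin M → Fin (N + N * M)
  new u w = N ↑ʳ combine u w

  -- remQuot-combine in the form to which corona reduces
  quotRem-combine : ∀ j w → quotRem {N} M (combine j w) ≡ (w , j)
  quotRem-combine j w = cong swap (remQuot-combine j w)

  old-old : ∀ a b → corona H K (old a) (old b) ≡ H a b
  old-old a b rewrite splitAt-↑ˡ N a (N * M) | splitAt-↑ˡ N b (N * M) = refl

  old-new : ∀ a j w → corona H K (old a) (new j w) ≡ (if ⌊ a ≟ j ⌋ then just (μ H a · μ K w) else nothing)
  old-new a j w rewrite splitAt-↑ˡ N a (N * M) | splitAt-↑ʳ N (N * M) (combine j w)
    | quotRem-combine j w = refl

  new-old : ∀ u w b → corona H K (new u w) (old b) ≡ (if ⌊ b ≟ u ⌋ then just (μ H b · μ K w) else nothing)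
  new-old u w b rewrite splitAt-↑ˡ N b (N * M) | splitAt-↑ʳ N (N * M) (combine u w)
    | quotRem-combine u w = refl

  new-new : ∀ u w j w' → corona H K (new u w) (new j w') ≡ (if ⌊ u ≟ j ⌋ then K w w' else nothing)
  new-new u w j w' rewrite splitAt-↑ʳ N (N * M) (combine u w) | splitAt-↑ʳ N (N * M) (combine j w')
    | quotRem-combine u w | quotRem-combine j w' = refl

  Σ-nodes : (f : Fin (N + N * M) → ℕ) →
    Σ f ≡ Σ (λ b → f (old b)) + Σ {N} (λ j → Σ {M} (λ w → f (new j w)))
  Σ-nodes f = trans (Σ-↑ N f) (cong (Σ (λ b → f (old b)) +_) (Σ-combine N (λ y → f (N ↑ʳ y))))

  -- A node a of H gains one edge to every node of its own copy of K; such an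
  -- edge has sign s iff the node of K is marked s · μ(a).
  deg-old : ∀ s a → deg s (corona H K) (old a) ≡ deg s H a + count (s · μ H a) K
  deg-old s a = trans (Σ-nodes _) (cong₂ _+_ (Σ-cong (λ b → cong (isSign s) (old-old a b)))
                                         (trans (Σ-single a _ other-copy) own-copy))
    where
    other-copy : ∀ j → j ≢ a → Σ (λ w → isSign s (corona H K (old a) (new j w))) ≡ 0
    other-copy j j≢a = Σ-zero _ (λ w → trans (cong (isSign s)
      (trans (old-new a j w) (if-no (a ≟ j) (λ a≡j → j≢a (sym a≡j))))) (isSign-nothing s))
    own-copy : Σ (λ w → isSign s (corona H K (old a) (new a w))) ≡ count (s · μ H a) K
    own-copy = Σ-cong (λ w → trans (cong (isSign s) (trans (old-new a a w) (if-yes (a ≟ a) refl)))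
                                   (isSign-shift s (μ H a) (μ K w)))

  -- A node of the copy of K at u keeps its edges in K and gains one edge to u.
  deg-new : ∀ s u w → deg s (corona H K) (new u w) ≡ isSign s (just (μ H u · μ K w)) + deg s K w
  deg-new s u w = trans (Σ-nodes _) (cong₂ _+_ (trans (Σ-single u _ not-u) at-u)
                                              (trans (Σ-single u _ other-copy) own-copy))
    where
    not-u : ∀ b → b ≢ u → isSign s (corona H K (new u w) (old b)) ≡ 0
    not-u b b≢u = trans (cong (isSign s) (trans (new-old u w b) (if-no (b ≟ u) b≢u))) (isSign-nothing s)
    at-u : isSign s (corona H K (new u w) (old u)) ≡ isSign s (just (μ H u · μ K w))
    at-u = cong (isSign s) (trans (new-old u w u) (if-yes (u ≟ u) refl))
    other-copy : ∀ j → j ≢ u → Σ (λ w' → isSign s (corona H K (new u w) (new j w'))) ≡ 0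
    other-copy j j≢u = Σ-zero _ (λ w' → trans (cong (isSign s)
      (trans (new-new u w j w') (if-no (u ≟ j) (λ u≡j → j≢u (sym u≡j))))) (isSign-nothing s))
    own-copy : Σ (λ w' → isSign s (corona H K (new u w) (new u w'))) ≡ deg s K w
    own-copy = Σ-cong (λ w' → cong (isSign s) (trans (new-new u w u w') (if-yes (u ≟ u) refl)))

  state-old : ∀ a → stateOf (corona H K) (old a) ≡ step (λ s → count s K) (stateOf H a)
  state-old a = ⟨⟩-cong mark-old (deg-old pos a) (deg-old neg a)
    where
    open ≡-Reasoning
    mark-old : μ (corona H K) (old a) ≡ nextMark (λ s → count s K) (μ H a)
    mark-old = begin
      μ (corona H K) (old a)                          ≡⟨ μ≡neg^d⁻ (corona H K) (old a) ⟩
      neg^ (d⁻ (corona H K) (old a))                  ≡⟨ cong neg^ (deg-old neg a) ⟩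
      neg^ (d⁻ H a + count (neg · μ H a) K)           ≡⟨ neg^-+ (d⁻ H a) _ ⟩
      neg^ (d⁻ H a) · neg^ (count (neg · μ H a) K)    ≡⟨ cong (_· neg^ (count (neg · μ H a) K)) (μ≡neg^d⁻ H a) ⟨
      μ H a · neg^ (count (neg · μ H a) K)            ∎

  state-new : ∀ u w → stateOf (corona H K) (new u w) ≡ seed (μ H u) (μ H u · μ K w) (d⁺ K w) (d⁻ K w)
  state-new u w = trans (⟨⟩-cong mark-new (deg-new pos u w) (deg-new neg u w))
                        (seed-spec (μ H u) (μ H u · μ K w) (d⁺ K w) (d⁻ K w))
    where
    open ≡-Reasoning
    e : Sign
    e = μ H u · μ K w
    mark-new : μ (corona H K) (new u w) ≡ μ H u
    mark-new = begin
      μ (corona H K) (new u w)                       ≡⟨ μ≡neg^d⁻ (corona H K) (new u w) ⟩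
      neg^ (d⁻ (corona H K) (new u w))               ≡⟨ cong neg^ (deg-new neg u w) ⟩
      neg^ (isSign neg (just e) + d⁻ K w)            ≡⟨ neg^-+ (isSign neg (just e)) (d⁻ K w) ⟩
      neg^ (isSign neg (just e)) · neg^ (d⁻ K w)     ≡⟨ cong₂ _·_ (neg^-isSign e) (sym (μ≡neg^d⁻ K w)) ⟩
      e · μ K w                                      ≡⟨ ·-cancelʳ (μ H u) (μ K w) ⟩
      μ H u                                          ∎

trajectory : ∀ {n} (G : SGraph n) i k (x : Fin (size n i)) →
  stateOf (coronaPow G (k + i)) (emb n i k x) ≡ fold (stateOf (coronaPow G i) x) (step (λ s → count s G)) k
trajectory G i zero x = refl
trajectory G i (suc k) x =
  trans (Corona.state-old (coronaPow G (k + i)) G (emb _ i k x)) (cong (step (λ s → count s G)) (trajectory G i k x))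

trajectory-new : ∀ {n} (G : SGraph n) j k (u : Fin (size n j)) (w : Fin n) →
  stateOf (coronaPow G (k + suc j)) (emb n (suc j) k (newNode n j u w))
    ≡ run (λ s → count s G) k (d⁺ G w) (d⁻ G w) (μ (coronaPow G j) u) (μ G w)
trajectory-new G j k u w =
  trans (trajectory G (suc j) k (newNode _ j u w))
        (cong (λ x → fold x (step (λ s → count s G)) k) (Corona.state-new (coronaPow G j) G u w))

degrees : ∀ {x s a b} → x ≡ ⟨ s , a , b ⟩ → plus x ≡ a × minus x ≡ b
degrees eq = cong plus eq , cong minus eq

module Dynamics (c : Sign → ℕ) where
  open +-*-Solver

  linear : ∀ a k P → a + k * P + P ≡ a + suc k * P
  linear = solve 3 (λ a k P → a :+ k :* P :+ P := a :+ (con 1 :+ k) :* P) refl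

  fixed-run : ∀ {s} → nextMark c s ≡ s → ∀ k a b →
    fold ⟨ s , a , b ⟩ (step c) k ≡ ⟨ s , a + k * c s , b + k * c (neg · s) ⟩
  fixed-run fix zero a b = sym (⟨⟩-cong refl (+-identityʳ a) (+-identityʳ b))
  fixed-run {s} fix (suc k) a b =
    trans (cong (step c) (fixed-run fix k a b))
          (⟨⟩-cong fix (linear a k (c s)) (linear b k (c (neg · s))))

  flip-run : ∀ {s s'} → nextMark c s ≡ s' → nextMark c s' ≡ s' → ∀ k a b →
    fold ⟨ s , a , b ⟩ (step c) (suc k)
      ≡ ⟨ s' , a + c s + k * c s' , b + c (neg · s) + k * c (neg · s') ⟩
  flip-run {s} {s'} flip fix k a b = begin
    fold ⟨ s , a , b ⟩ (step c) (suc k)                       ≡⟨ cong (fold _ (step c)) (+-comm 1 k) ⟩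
    fold ⟨ s , a , b ⟩ (step c) (k + 1)                       ≡⟨ fold-+ _ (step c) k ⟩
    fold ⟨ nextMark c s , a + c s , b + c (neg · s) ⟩ (step c) k
                     ≡⟨ cong (λ t → fold ⟨ t , a + c s , b + c (neg · s) ⟩ (step c) k) flip ⟩
    fold ⟨ s' , a + c s , b + c (neg · s) ⟩ (step c) k         ≡⟨ fixed-run fix k _ _ ⟩
    ⟨ s' , a + c s + k * c s' , b + c (neg · s) + k * c (neg · s') ⟩ ∎
    where open ≡-Reasoning

  -- When every marking flips, two steps add c pos + c neg edges of each sign.
  module Alternating (alt : ∀ s → nextMark c s ≡ neg · s) where

    two-steps : ∀ s a b → step c (step c ⟨ s , a , b ⟩) ≡ ⟨ s , a + (c pos + c neg) , b + (c pos + c neg) ⟩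
    two-steps pos a b rewrite alt pos | alt neg =
      ⟨⟩-cong refl (+-assoc a _ _) (trans (+-assoc b _ _) (cong (b +_) (+-comm (c neg) (c pos))))
    two-steps neg a b rewrite alt neg | alt pos =
      ⟨⟩-cong refl (trans (+-assoc a _ _) (cong (a +_) (+-comm (c neg) (c pos)))) (+-assoc b _ _)

    even-run : ∀ h s a b →
      fold ⟨ s , a , b ⟩ (step c) (h * 2) ≡ ⟨ s , a + h * (c pos + c neg) , b + h * (c pos + c neg) ⟩
    even-run zero s a b = sym (⟨⟩-cong refl (+-identityʳ a) (+-identityʳ b))
    even-run (suc h) s a b =
      trans (cong (λ x → step c (step c x)) (even-run h s a b))
            (trans (two-steps s _ _) (⟨⟩-cong refl (linear a h _) (linear b h _)))

    odd-run : ∀ h s a b →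
      fold ⟨ s , a , b ⟩ (step c) (1 + h * 2)
        ≡ ⟨ neg · s , a + suc h * c s + h * c (neg · s) , b + suc h * c (neg · s) + h * c s ⟩
    odd-run h s a b =
      trans (cong (step c) (even-run h s a b))
            (⟨⟩-cong (alt s) (arith a (c s) (c (neg · s)) (total s)) (arith b (c (neg · s)) (c s) (total' s)))
      where
      arith : ∀ x P Q → c pos + c neg ≡ P + Q → x + h * (c pos + c neg) + P ≡ x + suc h * P + h * Q
      arith x P Q eq rewrite eq =
        solve 4 (λ x h P Q → x :+ h :* (P :+ Q) :+ P := x :+ (con 1 :+ h) :* P :+ h :* Q) refl x h P Q
      total : ∀ s → c pos + c neg ≡ c s + c (neg · s)
      total pos = refl
      total neg = +-comm (c pos) (c neg)
      total' : ∀ s → c pos + c neg ≡ c (neg · s) + c s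
      total' s = trans (total s) (+-comm (c s) (c (neg · s)))

  -- The statement distinguishes whether a corona step happened after the
  -- node was created (i < m) or not (m ≡ i); here m = k + i.
  flip-or-not : ∀ {s s'} → nextMark c s ≡ s' → nextMark c s' ≡ s' → ∀ i k a b →
    let x = fold ⟨ s , a , b ⟩ (step c) k in
    (i < k + i → plus x ≡ a + c s + (k ∸ 1) * c s' × minus x ≡ b + c (neg · s) + (k ∸ 1) * c (neg · s'))
    × (k + i ≡ i → plus x ≡ a × minus x ≡ b)
  flip-or-not flip fix i zero a b = (λ i<i → ⊥-elim (<-irrefl refl i<i)) , (λ _ → refl , refl)
  flip-or-not flip fix i (suc k) a b =
    (λ _ → degrees (flip-run flip fix k a b)) , (λ eq → ⊥-elim (m≢1+n+m i (sym eq)))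

-- The four cases of the theorem, for a node created at step i, k = m − i
-- steps before the end, with degrees d0⁺ d0⁻ and marking μ0 in G, attached
-- to a node marked μu, and final degrees D⁺ D⁻.

OddOddFormulas : (i k n n₊ n₋ d0⁺ d0⁻ : ℕ) (μu μ0 : Sign) (D⁺ D⁻ : ℕ) → Set
OddOddFormulas i k n n₊ n₋ d0⁺ d0⁻ μu μ0 D⁺ D⁻ = let m = k + i in
  (¬ (2 ∣ n₊) → ¬ (2 ∣ n₋) →
    (m % 2 ≡ i % 2 →
      ((μu ≡ pos → μ0 ≡ pos →
         D⁺ ≡ d0⁺ + 1 + ((m ∸ i) / 2) * n × D⁻ ≡ d0⁻ + ((m ∸ i) / 2) * n)
      × (μu ≡ neg → μ0 ≡ neg →
         D⁺ ≡ d0⁺ + 1 + ((m ∸ i) / 2) * n × D⁻ ≡ d0⁻ + ((m ∸ i) / 2) * n)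
      × (μu ≡ pos → μ0 ≡ neg →
         D⁺ ≡ d0⁺ + ((m ∸ i) / 2) * n × D⁻ ≡ d0⁻ + 1 + ((m ∸ i) / 2) * n)
      × (μu ≡ neg → μ0 ≡ pos →
         D⁺ ≡ d0⁺ + ((m ∸ i) / 2) * n × D⁻ ≡ d0⁻ + 1 + ((m ∸ i) / 2) * n)))
    × (¬ (m % 2 ≡ i % 2) →
      ((μu ≡ pos → μ0 ≡ pos →
         D⁺ ≡ d0⁺ + 1 + ((m ∸ i + 1) / 2) * n₊ + ((m ∸ i ∸ 1) / 2) * n₋
         × D⁻ ≡ d0⁻ + ((m ∸ i + 1) / 2) * n₋ + ((m ∸ i ∸ 1) / 2) * n₊)
      × (μu ≡ pos → μ0 ≡ neg →
         D⁺ ≡ d0⁺ + ((m ∸ i + 1) / 2) * n₊ + ((m ∸ i ∸ 1) / 2) * n₋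
         × D⁻ ≡ d0⁻ + 1 + ((m ∸ i + 1) / 2) * n₋ + ((m ∸ i ∸ 1) / 2) * n₊)
      × (μu ≡ neg → μ0 ≡ pos →
         D⁺ ≡ d0⁺ + ((m ∸ i + 1) / 2) * n₋ + ((m ∸ i ∸ 1) / 2) * n₊
         × D⁻ ≡ d0⁻ + 1 + ((m ∸ i + 1) / 2) * n₊ + ((m ∸ i ∸ 1) / 2) * n₋)
      × (μu ≡ neg → μ0 ≡ neg →
         D⁺ ≡ d0⁺ + 1 + ((m ∸ i + 1) / 2) * n₋ + ((m ∸ i ∸ 1) / 2) * n₊
         × D⁻ ≡ d0⁻ + ((m ∸ i + 1) / 2) * n₊ + ((m ∸ i ∸ 1) / 2) * n₋))))

EvenOddFormulas : (i k n₊ n₋ d0⁺ d0⁻ : ℕ) (μu μ0 : Sign) (D⁺ D⁻ : ℕ) → Set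
EvenOddFormulas i k n₊ n₋ d0⁺ d0⁻ μu μ0 D⁺ D⁻ = let m = k + i in
  (2 ∣ n₊ → ¬ (2 ∣ n₋) →
      (μu ≡ pos → μ0 ≡ pos →
         (i < m → D⁺ ≡ d0⁺ + 1 + n₊ + (m ∸ i ∸ 1) * n₋
                  × D⁻ ≡ d0⁻ + n₋ + (m ∸ i ∸ 1) * n₊)
       × (m ≡ i → D⁺ ≡ d0⁺ + 1 × D⁻ ≡ d0⁻))
    × (μu ≡ pos → μ0 ≡ neg →
         (i < m → D⁺ ≡ d0⁺ + n₊ + (m ∸ i ∸ 1) * n₋
                  × D⁻ ≡ d0⁻ + 1 + n₋ + (m ∸ i ∸ 1) * n₊)
       × (m ≡ i → D⁺ ≡ d0⁺ × D⁻ ≡ d0⁻ + 1))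
    × (μu ≡ neg → μ0 ≡ pos →
         D⁺ ≡ d0⁺ + (m ∸ i) * n₋ × D⁻ ≡ d0⁻ + 1 + (m ∸ i) * n₊)
    × (μu ≡ neg → μ0 ≡ neg →
         D⁺ ≡ d0⁺ + 1 + (m ∸ i) * n₋ × D⁻ ≡ d0⁻ + (m ∸ i) * n₊))

EvenEvenFormulas : (i k n₊ n₋ d0⁺ d0⁻ : ℕ) (μu μ0 : Sign) (D⁺ D⁻ : ℕ) → Set
EvenEvenFormulas i k n₊ n₋ d0⁺ d0⁻ μu μ0 D⁺ D⁻ = let m = k + i in
  (2 ∣ n₊ → 2 ∣ n₋ →
      (μu ≡ pos → μ0 ≡ pos →
         D⁺ ≡ d0⁺ + 1 + (m ∸ i) * n₊ × D⁻ ≡ d0⁻ + (m ∸ i) * n₋)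
    × (μu ≡ pos → μ0 ≡ neg →
         D⁺ ≡ d0⁺ + (m ∸ i) * n₊ × D⁻ ≡ d0⁻ + 1 + (m ∸ i) * n₋)
    × (μu ≡ neg → μ0 ≡ pos →
         D⁺ ≡ d0⁺ + (m ∸ i) * n₋ × D⁻ ≡ d0⁻ + 1 + (m ∸ i) * n₊)
    × (μu ≡ neg → μ0 ≡ neg →
         D⁺ ≡ d0⁺ + 1 + (m ∸ i) * n₋ × D⁻ ≡ d0⁻ + (m ∸ i) * n₊))

OddEvenFormulas : (i k n₊ n₋ d0⁺ d0⁻ : ℕ) (μu μ0 : Sign) (D⁺ D⁻ : ℕ) → Set
OddEvenFormulas i k n₊ n₋ d0⁺ d0⁻ μu μ0 D⁺ D⁻ = let m = k + i in
  (¬ (2 ∣ n₊) → 2 ∣ n₋ →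
      (μu ≡ pos → μ0 ≡ pos →
         D⁺ ≡ d0⁺ + 1 + (m ∸ i) * n₊ × D⁻ ≡ d0⁻ + (m ∸ i) * n₋)
    × (μu ≡ pos → μ0 ≡ neg →
         D⁺ ≡ d0⁺ + (m ∸ i) * n₊ × D⁻ ≡ d0⁻ + 1 + (m ∸ i) * n₋)
    × (μu ≡ neg → μ0 ≡ pos →
         (i < m → D⁺ ≡ d0⁺ + n₋ + (m ∸ i ∸ 1) * n₊
                  × D⁻ ≡ d0⁻ + 1 + n₊ + (m ∸ i ∸ 1) * n₋)
       × (m ≡ i → D⁺ ≡ d0⁺ × D⁻ ≡ d0⁻ + 1))
    × (μu ≡ neg → μ0 ≡ neg →
         (i < m → D⁺ ≡ d0⁺ + 1 + n₋ + (m ∸ i ∸ 1) * n₊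
                  × D⁻ ≡ d0⁻ + n₊ + (m ∸ i ∸ 1) * n₋)
       × (m ≡ i → D⁺ ≡ d0⁺ + 1 × D⁻ ≡ d0⁻)))

DegreeFormulas : (i k n n₊ n₋ d0⁺ d0⁻ : ℕ) (μu μ0 : Sign) (D⁺ D⁻ : ℕ) → Set
DegreeFormulas i k n n₊ n₋ d0⁺ d0⁻ μu μ0 D⁺ D⁻ =
  OddOddFormulas i k n n₊ n₋ d0⁺ d0⁻ μu μ0 D⁺ D⁻ × EvenOddFormulas i k n₊ n₋ d0⁺ d0⁻ μu μ0 D⁺ D⁻
  × EvenEvenFormulas i k n₊ n₋ d0⁺ d0⁻ μu μ0 D⁺ D⁻ × OddEvenFormulas i k n₊ n₋ d0⁺ d0⁻ μu μ0 D⁺ D⁻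

module _ (c : Sign → ℕ) (i d0⁺ d0⁻ : ℕ) where
  open Dynamics c

  -- n₊, n₋ even: every marking is fixed.
  evenEven : ∀ k μu μ0 → let x = run c k d0⁺ d0⁻ μu μ0 in
    EvenEvenFormulas i k (c pos) (c neg) d0⁺ d0⁻ μu μ0 (plus x) (minus x)
  evenEven k μu μ0 p-even q-even rewrite m+n∸n≡m k i =
      (λ { refl refl → degrees (fixed-run pos-fixed k _ _) })
    , (λ { refl refl → degrees (fixed-run pos-fixed k _ _) })
    , (λ { refl refl → degrees (fixed-run neg-fixed k _ _) })
    , (λ { refl refl → degrees (fixed-run neg-fixed k _ _) })
    where
    pos-fixed : nextMark c pos ≡ pos
    pos-fixed = even⇒neg^≡pos q-even
    neg-fixed : nextMark c neg ≡ neg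
    neg-fixed = cong (neg ·_) (even⇒neg^≡pos p-even)

  -- n₊ even, n₋ odd: a negative marking is fixed, a positive one flips once.
  evenOdd : ∀ k μu μ0 → let x = run c k d0⁺ d0⁻ μu μ0 in
    EvenOddFormulas i k (c pos) (c neg) d0⁺ d0⁻ μu μ0 (plus x) (minus x)
  evenOdd k μu μ0 p-even q-odd rewrite m+n∸n≡m k i =
      (λ { refl refl → flip-or-not pos-flips neg-fixed i k _ _ })
    , (λ { refl refl → flip-or-not pos-flips neg-fixed i k _ _ })
    , (λ { refl refl → degrees (fixed-run neg-fixed k _ _) })
    , (λ { refl refl → degrees (fixed-run neg-fixed k _ _) })
    where
    pos-flips : nextMark c pos ≡ neg
    pos-flips = odd⇒neg^≡neg q-odd
    neg-fixed : nextMark c neg ≡ neg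
    neg-fixed = cong (neg ·_) (even⇒neg^≡pos p-even)

  -- n₊ odd, n₋ even: a positive marking is fixed, a negative one flips once.
  oddEven : ∀ k μu μ0 → let x = run c k d0⁺ d0⁻ μu μ0 in
    OddEvenFormulas i k (c pos) (c neg) d0⁺ d0⁻ μu μ0 (plus x) (minus x)
  oddEven k μu μ0 p-odd q-even rewrite m+n∸n≡m k i =
      (λ { refl refl → degrees (fixed-run pos-fixed k _ _) })
    , (λ { refl refl → degrees (fixed-run pos-fixed k _ _) })
    , (λ { refl refl → flip-or-not neg-flips pos-fixed i k _ _ })
    , (λ { refl refl → flip-or-not neg-flips pos-fixed i k _ _ })
    where
    pos-fixed : nextMark c pos ≡ pos
    pos-fixed = even⇒neg^≡pos q-even
    neg-flips : nextMark c neg ≡ pos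
    neg-flips = cong (neg ·_) (odd⇒neg^≡neg p-odd)

  alternating : ¬ (2 ∣ c pos) → ¬ (2 ∣ c neg) → ∀ s → nextMark c s ≡ neg · s
  alternating p-odd q-odd pos = odd⇒neg^≡neg q-odd
  alternating p-odd q-odd neg = cong (neg ·_) (odd⇒neg^≡neg p-odd)

  -- Hence the formulas for n₊, n₋ odd depend on the parity of k = m − i.
  oddOdd : ∀ k μu μ0 → let x = run c k d0⁺ d0⁻ μu μ0 in
    OddOddFormulas i k (c pos + c neg) (c pos) (c neg) d0⁺ d0⁻ μu μ0 (plus x) (minus x)
  oddOdd k μu μ0 p-odd q-odd with parity k
  ... | even h rewrite m+n∸n≡m (h * 2) i | half-even h =
        (λ _ → (λ { refl refl → degrees (even-run h pos _ _) })
             , (λ { refl refl → degrees (even-run h neg _ _) })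
             , (λ { refl refl → degrees (even-run h pos _ _) })
             , (λ { refl refl → degrees (even-run h neg _ _) }))
      , (λ different → ⊥-elim (different (even-+-%2 h i)))
    where open Alternating (alternating p-odd q-odd)
  ... | odd h rewrite m+n∸n≡m (1 + h * 2) i | half-odd-up h | half-even h =
        (λ same → ⊥-elim (odd-+-%2 h i same))
      , (λ _ → (λ { refl refl → degrees (odd-run h pos _ _) })
             , (λ { refl refl → degrees (odd-run h pos _ _) })
             , (λ { refl refl → degrees (odd-run h neg _ _) })
             , (λ { refl refl → degrees (odd-run h neg _ _) }))
    where open Alternating (alternating p-odd q-odd)

degree-formulas : ∀ (c : Sign → ℕ) i k n d0⁺ d0⁻ μu μ0 → n ≡ c pos + c neg →
  let x = run c k d0⁺ d0⁻ μu μ0 in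
  DegreeFormulas i k n (c pos) (c neg) d0⁺ d0⁻ μu μ0 (plus x) (minus x)
degree-formulas c i k _ d0⁺ d0⁻ μu μ0 refl =
  oddOdd c i d0⁺ d0⁻ k μu μ0 , evenOdd c i d0⁺ d0⁻ k μu μ0
  , evenEven c i d0⁺ d0⁻ k μu μ0 , oddEven c i d0⁺ d0⁻ k μu μ0

-- Theorem 6: the degrees in G^(m), m = k + i, of a node created at step
-- i = j + 1.
theorem6 : ∀ {n} (G : SGraph n) → IsSimple G →
  ∀ (j k : ℕ) (u : Fin (size n j)) (w : Fin n) →
  let i = suc j
      m = k + i
      v = emb n i k (newNode n j u w)
      Gm = coronaPow G m
      D⁺ = d⁺ Gm v
      D⁻ = d⁻ Gm v
      d0⁺ = d⁺ G w
      d0⁻ = d⁻ G w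
      μu = μ (coronaPow G j) u
      μ0 = μ G w
      n₊ = nPos G
      n₋ = nNeg G in
        -- (1) n₊, n₋ both odd
        (¬ (2 ∣ n₊) → ¬ (2 ∣ n₋) →
          (m % 2 ≡ i % 2 →
            ((μu ≡ pos → μ0 ≡ pos →
               D⁺ ≡ d0⁺ + 1 + ((m ∸ i) / 2) * n × D⁻ ≡ d0⁻ + ((m ∸ i) / 2) * n)
            × (μu ≡ neg → μ0 ≡ neg →
               D⁺ ≡ d0⁺ + 1 + ((m ∸ i) / 2) * n × D⁻ ≡ d0⁻ + ((m ∸ i) / 2) * n)
            × (μu ≡ pos → μ0 ≡ neg →
               D⁺ ≡ d0⁺ + ((m ∸ i) / 2) * n × D⁻ ≡ d0⁻ + 1 + ((m ∸ i) / 2) * n)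
            × (μu ≡ neg → μ0 ≡ pos →
               D⁺ ≡ d0⁺ + ((m ∸ i) / 2) * n × D⁻ ≡ d0⁻ + 1 + ((m ∸ i) / 2) * n)))
          × (¬ (m % 2 ≡ i % 2) →
            ((μu ≡ pos → μ0 ≡ pos →
               D⁺ ≡ d0⁺ + 1 + ((m ∸ i + 1) / 2) * n₊ + ((m ∸ i ∸ 1) / 2) * n₋
               × D⁻ ≡ d0⁻ + ((m ∸ i + 1) / 2) * n₋ + ((m ∸ i ∸ 1) / 2) * n₊)
            × (μu ≡ pos → μ0 ≡ neg →
               D⁺ ≡ d0⁺ + ((m ∸ i + 1) / 2) * n₊ + ((m ∸ i ∸ 1) / 2) * n₋
               × D⁻ ≡ d0⁻ + 1 + ((m ∸ i + 1) / 2) * n₋ + ((m ∸ i ∸ 1) / 2) * n₊)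
            × (μu ≡ neg → μ0 ≡ pos →
               D⁺ ≡ d0⁺ + ((m ∸ i + 1) / 2) * n₋ + ((m ∸ i ∸ 1) / 2) * n₊
               × D⁻ ≡ d0⁻ + 1 + ((m ∸ i + 1) / 2) * n₊ + ((m ∸ i ∸ 1) / 2) * n₋)
            × (μu ≡ neg → μ0 ≡ neg →
               D⁺ ≡ d0⁺ + 1 + ((m ∸ i + 1) / 2) * n₋ + ((m ∸ i ∸ 1) / 2) * n₊
               × D⁻ ≡ d0⁻ + ((m ∸ i + 1) / 2) * n₊ + ((m ∸ i ∸ 1) / 2) * n₋))))
        -- (2) n₊ even, n₋ odd
        × (2 ∣ n₊ → ¬ (2 ∣ n₋) →
            (μu ≡ pos → μ0 ≡ pos →
               (i < m → D⁺ ≡ d0⁺ + 1 + n₊ + (m ∸ i ∸ 1) * n₋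
                        × D⁻ ≡ d0⁻ + n₋ + (m ∸ i ∸ 1) * n₊)
             × (m ≡ i → D⁺ ≡ d0⁺ + 1 × D⁻ ≡ d0⁻))
          × (μu ≡ pos → μ0 ≡ neg →
               (i < m → D⁺ ≡ d0⁺ + n₊ + (m ∸ i ∸ 1) * n₋
                        × D⁻ ≡ d0⁻ + 1 + n₋ + (m ∸ i ∸ 1) * n₊)
             × (m ≡ i → D⁺ ≡ d0⁺ × D⁻ ≡ d0⁻ + 1))
          × (μu ≡ neg → μ0 ≡ pos →
               D⁺ ≡ d0⁺ + (m ∸ i) * n₋ × D⁻ ≡ d0⁻ + 1 + (m ∸ i) * n₊)
          × (μu ≡ neg → μ0 ≡ neg →
               D⁺ ≡ d0⁺ + 1 + (m ∸ i) * n₋ × D⁻ ≡ d0⁻ + (m ∸ i) * n₊))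
        -- (3) n₊, n₋ both even
        × (2 ∣ n₊ → 2 ∣ n₋ →
            (μu ≡ pos → μ0 ≡ pos →
               D⁺ ≡ d0⁺ + 1 + (m ∸ i) * n₊ × D⁻ ≡ d0⁻ + (m ∸ i) * n₋)
          × (μu ≡ pos → μ0 ≡ neg →
               D⁺ ≡ d0⁺ + (m ∸ i) * n₊ × D⁻ ≡ d0⁻ + 1 + (m ∸ i) * n₋)
          × (μu ≡ neg → μ0 ≡ pos →
               D⁺ ≡ d0⁺ + (m ∸ i) * n₋ × D⁻ ≡ d0⁻ + 1 + (m ∸ i) * n₊)
          × (μu ≡ neg → μ0 ≡ neg →
               D⁺ ≡ d0⁺ + 1 + (m ∸ i) * n₋ × D⁻ ≡ d0⁻ + (m ∸ i) * n₊))
        -- (4) n₊ odd, n₋ even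
        × (¬ (2 ∣ n₊) → 2 ∣ n₋ →
            (μu ≡ pos → μ0 ≡ pos →
               D⁺ ≡ d0⁺ + 1 + (m ∸ i) * n₊ × D⁻ ≡ d0⁻ + (m ∸ i) * n₋)
          × (μu ≡ pos → μ0 ≡ neg →
               D⁺ ≡ d0⁺ + (m ∸ i) * n₊ × D⁻ ≡ d0⁻ + 1 + (m ∸ i) * n₋)
          × (μu ≡ neg → μ0 ≡ pos →
               (i < m → D⁺ ≡ d0⁺ + n₋ + (m ∸ i ∸ 1) * n₊
                        × D⁻ ≡ d0⁻ + 1 + n₊ + (m ∸ i ∸ 1) * n₋)
             × (m ≡ i → D⁺ ≡ d0⁺ × D⁻ ≡ d0⁻ + 1))
          × (μu ≡ neg → μ0 ≡ neg →
               (i < m → D⁺ ≡ d0⁺ + 1 + n₋ + (m ∸ i ∸ 1) * n₊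
                        × D⁻ ≡ d0⁻ + n₊ + (m ∸ i ∸ 1) * n₋)
             × (m ≡ i → D⁺ ≡ d0⁺ + 1 × D⁻ ≡ d0⁻)))
theorem6 {n} G _ j k u w =
  subst₂ (DegreeFormulas (suc j) k n (nPos G) (nNeg G) (d⁺ G w) (d⁻ G w) μu (μ G w))
         (cong plus (sym final-state)) (cong minus (sym final-state))
         (degree-formulas (λ s → count s G) (suc j) k n (d⁺ G w) (d⁻ G w) μu (μ G w) (count-total G))
  where
  μu : Sign
  μu = μ (coronaPow G j) u
  final-state : stateOf (coronaPow G (k + suc j)) (emb n (suc j) k (newNode n j u w))
              ≡ run (λ s → count s G) k (d⁺ G w) (d⁻ G w) μu (μ G w)
  final-state = trajectory-new G j k u w
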